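{- Let $z \in \mathbb{Z}$ and \[ f_{z}(X) = X^{4} - zX^{3} - \frac{3z^{6}-16z^{4}+37z^{2}-32}{8} X^{2} - \frac{2z^{9}-19z^{7}+72z^{5}-135z^{3}+96z}{16} X - \frac{3z^{12}-40z^{10}+214z^{8}-576z^{6}+719z^{4}-64z^{2}-512}{256}. \] (a) $f_{z}(X) \in \mathbb{Z}[X]$ if and only if $z \not\equiv 2 \pmod{4}$. (b) $f_{z}(X-1/2) \in \mathbb{Z}[X]$ if and only if $z \equiv 2 \pmod{4}$. -}

module Defs where

open import Data.Nat using (ℕ)
open import Data.Integer as Z using (ℤ; +_)
open import Data.Rational as ℚ using (ℚ; _/_; _+_; _*_; -_; 0ℚ)
open import Data.List using (List; []; _∷_)
open import Data.List.Relation.Unary.All using (All)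
open import Data.Product using (Σ)
open import Relation.Binary.PropositionalEquality using (_≡_)

-- Polynomials with rational coefficients, as coefficient lists,
-- lowest degree first: a₀ ∷ a₁ ∷ … represents a₀ + a₁ X + ….
Poly : Set
Poly = List ℚ

IsInt : ℚ → Set
IsInt q = Σ ℤ (λ k → q ≡ k / 1)

InZX : Poly → Set
InZX p = All IsInt p

_⊕_ : Poly → Poly → Poly
[] ⊕ q = q
(a ∷ p) ⊕ [] = a ∷ p
(a ∷ p) ⊕ (b ∷ q) = (a + b) ∷ (p ⊕ q)

scale : ℚ → Poly → Poly
scale c [] = []
scale c (a ∷ p) = c * a ∷ scale c p

mulLin : ℚ → Poly → Poly
mulLin c p = (0ℚ ∷ p) ⊕ scale c p

-- substitution: shift c p  represents  p(X + c)   (Horner scheme)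
shift : ℚ → Poly → Poly
shift c [] = []
shift c (a ∷ p) = (a ∷ []) ⊕ mulLin c (shift c p)

f : ℤ → Poly
f z = c0 ∷ c1 ∷ c2 ∷ c3 ∷ (1ℤ / 1) ∷ []
  where
  open Z using (_^_; _-_)
  1ℤ : ℤ
  1ℤ = + 1
  n2 n1 n0 : ℤ
  n2 = + 3 Z.* z ^ 6 - + 16 Z.* z ^ 4 Z.+ + 37 Z.* z ^ 2 - + 32
  n1 = + 2 Z.* z ^ 9 - + 19 Z.* z ^ 7 Z.+ + 72 Z.* z ^ 5 - + 135 Z.* z ^ 3 Z.+ + 96 Z.* z
  n0 = + 3 Z.* z ^ 12 - + 40 Z.* z ^ 10 Z.+ + 214 Z.* z ^ 8 - + 576 Z.* z ^ 6
       Z.+ + 719 Z.* z ^ 4 - + 64 Z.* z ^ 2 - + 512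
  c3 c2 c1 c0 : ℚ
  c3 = - (z / 1)
  c2 = - (n2 / 8)
  c1 = - (n1 / 16)
  c0 = - (n0 / 256)

{-# OPTIONS --safe #-}
-- Every coefficient of f_z and of f_z(X - 1/2) has the form N(z) / D with N ∈ ℤ[z] and D a
-- power of 2; for the shifted polynomial these fractions are obtained by running the Horner
-- shift symbolically.  Writing z = r + 4s with 0 ≤ r < 4, integrality is decided for all s at
-- once by expanding N(r + 4s) in s: either D divides every coefficient of this polynomial, or D
-- divides every coefficient but the constant one, and then D ∤ N(r + 4s) for every s.  The
-- four residues r are checked by evaluation.
module Submission where

open import Defs
open import Data.Integer using (ℤ; +_; _-_)
open import Data.Integer.Divisibility using (_∣_)
open import Data.Rational using (_/_; -_)
open import Data.Product using (_×_)
open import Function.Bundles using (_⇔_)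
open import Relation.Nullary using (¬_)

open import Data.Empty using (⊥)
open import Data.Fin using (Fin; toℕ; fromℕ<)
open import Data.Fin.Properties as Fin using (toℕ-fromℕ<)
open import Data.Integer as ℤ using (_+_; _*_; 0ℤ; 1ℤ; -1ℤ)
open import Data.Integer.DivMod using (_%_; n%d<d; a≡a%n+[a/n]*n)
import Data.Integer.Divisibility.Signed as Signed
open Signed using (divides; ∣ᵤ⇒∣; ∣⇒∣ᵤ; ∣m∣n⇒∣m+n; ∣m∣n⇒∣m-n; ∣n⇒∣m*n)
import Data.Integer.Properties as ℤₚ
open import Data.Integer.Tactic.RingSolver using (solve-∀)
open import Data.List using (List; []; _∷_; map)
open import Data.List.Relation.Binary.Pointwise using (Pointwise-≡⇒≡; []; _∷_)
open import Data.List.Relation.Unary.All as All using (All; []; _∷_; all?)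
open import Data.List.Relation.Unary.All.Properties using (map⁺)
open import Data.List.Relation.Unary.Any using (Any; here; there; any?)
open import Data.Nat as ℕ using (ℕ; zero; suc)
open import Data.Product using (_,_)
open import Data.Rational as ℚ using (ℚ; 0ℚ; fromℚᵘ; toℚᵘ)
open import Data.Rational.Properties
  using (toℚᵘ-injective; toℚᵘ-fromℚᵘ; fromℚᵘ-injective; fromℚᵘ-cong
        ; toℚᵘ-homo-+; toℚᵘ-homo-*; toℚᵘ-homo‿-)
open import Data.Rational.Unnormalised as ℚᵘ using (ℚᵘ; mkℚᵘ; *≡*)
import Data.Rational.Unnormalised.Properties as ℚᵘ
open import Data.Sum using (_⊎_; inj₁; inj₂)
open import Function using (_∘_; const)
open import Function.Bundles using (mk⇔; Equivalence)
open import Relation.Binary.PropositionalEquality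
open import Relation.Nullary using (Dec; no; contradiction)
open import Relation.Nullary.Decidable using (from-yes; ¬?; _×-dec_; _⊎-dec_)
open import Relation.Unary using (Decidable)

infixl 6 _:+_ _:-_
infixl 7 _:*_
infixr 8 _:^_
infix  8 :-_

-- Expressions rather than coefficient lists, so that ⟦ e ⟧ z can be definitionally equal to
-- the integer expressions written in Defs.f.
data Expr : Set where
  X    : Expr
  con  : ℤ → Expr
  _:+_ : Expr → Expr → Expr
  _:*_ : Expr → Expr → Expr
  :-_  : Expr → Expr

_:-_ : Expr → Expr → Expr
e :- e′ = e :+ :- e′

_:^_ : Expr → ℕ → Expr
e :^ zero  = con 1ℤ
e :^ suc n = e :* e :^ n

⟦_⟧ : Expr → ℤ → ℤ
⟦ X       ⟧ x = x
⟦ con c   ⟧ x = c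
⟦ e :+ e′ ⟧ x = ⟦ e ⟧ x + ⟦ e′ ⟧ x
⟦ e :* e′ ⟧ x = ⟦ e ⟧ x * ⟦ e′ ⟧ x
⟦ :- e    ⟧ x = ℤ.- ⟦ e ⟧ x

infixl 9 _∘ₑ_

_∘ₑ_ : Expr → Expr → Expr
X         ∘ₑ q = q
con c     ∘ₑ q = con c
(e :+ e′) ∘ₑ q = e ∘ₑ q :+ e′ ∘ₑ q
(e :* e′) ∘ₑ q = e ∘ₑ q :* e′ ∘ₑ q
(:- e)    ∘ₑ q = :- (e ∘ₑ q)

⟦∘ₑ⟧ : ∀ e q x → ⟦ e ∘ₑ q ⟧ x ≡ ⟦ e ⟧ (⟦ q ⟧ x)
⟦∘ₑ⟧ X         q x = refl
⟦∘ₑ⟧ (con c)   q x = refl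
⟦∘ₑ⟧ (e :+ e′) q x = cong₂ _+_ (⟦∘ₑ⟧ e q x) (⟦∘ₑ⟧ e′ q x)
⟦∘ₑ⟧ (e :* e′) q x = cong₂ _*_ (⟦∘ₑ⟧ e q x) (⟦∘ₑ⟧ e′ q x)
⟦∘ₑ⟧ (:- e)    q x = cong ℤ.-_ (⟦∘ₑ⟧ e q x)

ZPoly : Set
ZPoly = List ℤ

eval : ZPoly → ℤ → ℤ
eval []      x = 0ℤ
eval (a ∷ p) x = a + x * eval p x

infixl 6 _⊞_
infixl 7 _⊠_ _⊛_

_⊞_ : ZPoly → ZPoly → ZPoly
[]      ⊞ q       = q
(a ∷ p) ⊞ []      = a ∷ p
(a ∷ p) ⊞ (b ∷ q) = a + b ∷ p ⊞ q

_⊛_ : ℤ → ZPoly → ZPoly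
c ⊛ p = map (c *_) p

_⊠_ : ZPoly → ZPoly → ZPoly
[]      ⊠ q = []
(a ∷ p) ⊠ q = a ⊛ q ⊞ (0ℤ ∷ p ⊠ q)

eval-⊞ : ∀ p q x → eval (p ⊞ q) x ≡ eval p x + eval q x
eval-⊞ []      q       x = sym (ℤₚ.+-identityˡ _)
eval-⊞ (a ∷ p) []      x = sym (ℤₚ.+-identityʳ _)
eval-⊞ (a ∷ p) (b ∷ q) x = begin
  a + b + x * eval (p ⊞ q) x              ≡⟨ cong (λ t → a + b + x * t) (eval-⊞ p q x) ⟩
  a + b + x * (eval p x + eval q x)       ≡⟨ interchange a b x (eval p x) (eval q x) ⟩
  a + x * eval p x + (b + x * eval q x)   ∎
  where
  open ≡-Reasoning
  interchange : ∀ a b x u v → a + b + x * (u + v) ≡ a + x * u + (b + x * v)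
  interchange = solve-∀

eval-⊛ : ∀ c p x → eval (c ⊛ p) x ≡ c * eval p x
eval-⊛ c []      x = sym (ℤₚ.*-zeroʳ c)
eval-⊛ c (a ∷ p) x = begin
  c * a + x * eval (c ⊛ p) x   ≡⟨ cong (λ t → c * a + x * t) (eval-⊛ c p x) ⟩
  c * a + x * (c * eval p x)   ≡⟨ distrib c a x (eval p x) ⟩
  c * (a + x * eval p x)       ∎
  where
  open ≡-Reasoning
  distrib : ∀ c a x u → c * a + x * (c * u) ≡ c * (a + x * u)
  distrib = solve-∀

eval-⊠ : ∀ p q x → eval (p ⊠ q) x ≡ eval p x * eval q x
eval-⊠ []      q x = refl
eval-⊠ (a ∷ p) q x = begin
  eval (a ⊛ q ⊞ (0ℤ ∷ p ⊠ q)) x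
    ≡⟨ eval-⊞ (a ⊛ q) (0ℤ ∷ p ⊠ q) x ⟩
  eval (a ⊛ q) x + (0ℤ + x * eval (p ⊠ q) x)
    ≡⟨ cong₂ (λ u v → u + (0ℤ + x * v)) (eval-⊛ a q x) (eval-⊠ p q x) ⟩
  a * eval q x + (0ℤ + x * (eval p x * eval q x))
    ≡⟨ distrib a x (eval p x) (eval q x) ⟩
  (a + x * eval p x) * eval q x
    ∎
  where
  open ≡-Reasoning
  distrib : ∀ a x u v → a * v + (0ℤ + x * (u * v)) ≡ (a + x * u) * v
  distrib = solve-∀

coefficients : Expr → ZPoly
coefficients X         = 0ℤ ∷ 1ℤ ∷ []
coefficients (con c)   = c ∷ []
coefficients (e :+ e′) = coefficients e ⊞ coefficients e′
coefficients (e :* e′) = coefficients e ⊠ coefficients e′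
coefficients (:- e)    = -1ℤ ⊛ coefficients e

eval-coefficients : ∀ e x → eval (coefficients e) x ≡ ⟦ e ⟧ x
eval-coefficients X         x = eval-X x
  where
  eval-X : ∀ x → 0ℤ + x * (1ℤ + x * 0ℤ) ≡ x
  eval-X = solve-∀
eval-coefficients (con c)   x = trans (cong (λ t → c + t) (ℤₚ.*-zeroʳ x)) (ℤₚ.+-identityʳ c)
eval-coefficients (e :+ e′) x = trans (eval-⊞ (coefficients e) (coefficients e′) x)
                                      (cong₂ _+_ (eval-coefficients e x) (eval-coefficients e′ x))
eval-coefficients (e :* e′) x = trans (eval-⊠ (coefficients e) (coefficients e′) x)
                                      (cong₂ _*_ (eval-coefficients e x) (eval-coefficients e′ x))
eval-coefficients (:- e)    x = trans (eval-⊛ -1ℤ (coefficients e) x)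
                                      (trans (ℤₚ.-1*i≡-i _) (cong ℤ.-_ (eval-coefficients e x)))

eval-coefficients-∘ₑ : ∀ e q s → eval (coefficients (e ∘ₑ q)) s ≡ ⟦ e ⟧ (⟦ q ⟧ s)
eval-coefficients-∘ₑ e q s = trans (eval-coefficients (e ∘ₑ q) s) (⟦∘ₑ⟧ e q s)

infix 4 _∣ₚ_ _∤₀_ _∣ₚ?_ _∤₀?_

_∣ₚ_ : ℤ → ZPoly → Set
d ∣ₚ p = All (d Signed.∣_) p

_∤₀_ : ℤ → ZPoly → Set
d ∤₀ []      = ⊥
d ∤₀ (a ∷ p) = ¬ d Signed.∣ a × d ∣ₚ p

_∣ₚ?_ : ∀ d → Decidable (d ∣ₚ_)
d ∣ₚ? p = all? (d Signed.∣?_) p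

_∤₀?_ : ∀ d → Decidable (d ∤₀_)
d ∤₀? []      = no λ ()
d ∤₀? (a ∷ p) = ¬? (d Signed.∣? a) ×-dec d ∣ₚ? p

∣ₚ⇒∣-eval : ∀ {d p} x → d ∣ₚ p → d Signed.∣ eval p x
∣ₚ⇒∣-eval x []           = divides 0ℤ refl
∣ₚ⇒∣-eval x (d∣a ∷ d∣ₚp) = ∣m∣n⇒∣m+n d∣a (∣n⇒∣m*n x (∣ₚ⇒∣-eval x d∣ₚp))

∤₀⇒∤-eval : ∀ {d} p x → d ∤₀ p → ¬ d Signed.∣ eval p x
∤₀⇒∤-eval {d} (a ∷ p) x (d∤a , d∣ₚp) d∣eval = d∤a (subst (d Signed.∣_) (cancel a (x * eval p x))
  (∣m∣n⇒∣m-n d∣eval (∣n⇒∣m*n x (∣ₚ⇒∣-eval x d∣ₚp))))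
  where
  cancel : ∀ a b → a + b - b ≡ a
  cancel = solve-∀

∣ₚ-along : ∀ {d} e q s → d ∣ₚ coefficients (e ∘ₑ q) → d Signed.∣ ⟦ e ⟧ (⟦ q ⟧ s)
∣ₚ-along {d} e q s = subst (d Signed.∣_) (eval-coefficients-∘ₑ e q s) ∘ ∣ₚ⇒∣-eval s

∤₀-along : ∀ {d} e q s → d ∤₀ coefficients (e ∘ₑ q) → ¬ d Signed.∣ ⟦ e ⟧ (⟦ q ⟧ s)
∤₀-along {d} e q s d∤₀ = ∤₀⇒∤-eval _ s d∤₀ ∘ subst (d Signed.∣_) (sym (eval-coefficients-∘ₑ e q s))

fromℚᵘ-homo-+ : ∀ p q → fromℚᵘ (p ℚᵘ.+ q) ≡ fromℚᵘ p ℚ.+ fromℚᵘ q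
fromℚᵘ-homo-+ p q = toℚᵘ-injective (begin
  toℚᵘ (fromℚᵘ (p ℚᵘ.+ q))               ≈⟨ toℚᵘ-fromℚᵘ (p ℚᵘ.+ q) ⟩
  p ℚᵘ.+ q                               ≈⟨ ℚᵘ.+-cong (toℚᵘ-fromℚᵘ p) (toℚᵘ-fromℚᵘ q) ⟨
  toℚᵘ (fromℚᵘ p) ℚᵘ.+ toℚᵘ (fromℚᵘ q)   ≈⟨ toℚᵘ-homo-+ (fromℚᵘ p) (fromℚᵘ q) ⟨
  toℚᵘ (fromℚᵘ p ℚ.+ fromℚᵘ q)           ∎)
  where open ℚᵘ.≃-Reasoning

fromℚᵘ-homo-* : ∀ p q → fromℚᵘ (p ℚᵘ.* q) ≡ fromℚᵘ p ℚ.* fromℚᵘ q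
fromℚᵘ-homo-* p q = toℚᵘ-injective (begin
  toℚᵘ (fromℚᵘ (p ℚᵘ.* q))               ≈⟨ toℚᵘ-fromℚᵘ (p ℚᵘ.* q) ⟩
  p ℚᵘ.* q                               ≈⟨ ℚᵘ.*-cong (toℚᵘ-fromℚᵘ p) (toℚᵘ-fromℚᵘ q) ⟨
  toℚᵘ (fromℚᵘ p) ℚᵘ.* toℚᵘ (fromℚᵘ q)   ≈⟨ toℚᵘ-homo-* (fromℚᵘ p) (fromℚᵘ q) ⟨
  toℚᵘ (fromℚᵘ p ℚ.* fromℚᵘ q)           ∎)
  where open ℚᵘ.≃-Reasoning

fromℚᵘ-homo‿- : ∀ p → fromℚᵘ (ℚᵘ.- p) ≡ ℚ.- fromℚᵘ p
fromℚᵘ-homo‿- p = toℚᵘ-injective (begin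
  toℚᵘ (fromℚᵘ (ℚᵘ.- p))   ≈⟨ toℚᵘ-fromℚᵘ (ℚᵘ.- p) ⟩
  ℚᵘ.- p                   ≈⟨ ℚᵘ.-‿cong (toℚᵘ-fromℚᵘ p) ⟨
  ℚᵘ.- toℚᵘ (fromℚᵘ p)     ≈⟨ toℚᵘ-homo‿- (fromℚᵘ p) ⟨
  toℚᵘ (ℚ.- fromℚᵘ p)      ∎)
  where open ℚᵘ.≃-Reasoning

isInt-/⇔∣ : ∀ n d .{{_ : ℕ.NonZero d}} → IsInt (n / d) ⇔ (+ d Signed.∣ n)
isInt-/⇔∣ n (suc d) = mk⇔ to from
  where
  to : IsInt (n / suc d) → + suc d Signed.∣ n
  to (k , n/d≡k) with fromℚᵘ-injective {mkℚᵘ n d} {mkℚᵘ k 0} n/d≡k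
  ... | *≡* n*1≡k*d = divides k (trans (sym (ℤₚ.*-identityʳ n)) n*1≡k*d)
  from : + suc d Signed.∣ n → IsInt (n / suc d)
  from (divides k n≡k*d) = k , fromℚᵘ-cong {mkℚᵘ n d} {mkℚᵘ k 0} (*≡* (trans (ℤₚ.*-identityʳ n) n≡k*d))

record Frac : Set where
  constructor mkFrac
  field
    numerator     : Expr
    denominator-1 : ℕ

open Frac

denominator : Frac → ℤ
denominator F = + suc (denominator-1 F)

⟦_⟧ᵘ : Frac → ℤ → ℚᵘ
⟦ mkFrac e d ⟧ᵘ x = mkℚᵘ (⟦ e ⟧ x) d

⟦_⟧ᶠ : Frac → ℤ → ℚ
⟦ F ⟧ᶠ x = fromℚᵘ (⟦ F ⟧ᵘ x)

infixl 6 _+ᶠ_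
infixl 7 _*ᶠ_
infix  8 -ᶠ_

0ᶠ : Frac
0ᶠ = mkFrac (con 0ℤ) 0

-- Numerators and denominators are those of the corresponding operations of ℚᵘ, so that
-- ⟦_⟧ᵘ commutes with them definitionally.
_+ᶠ_ : Frac → Frac → Frac
mkFrac e d +ᶠ mkFrac e′ d′ =
  mkFrac (e :* con (+ suc d′) :+ e′ :* con (+ suc d)) (ℕ.pred (suc d ℕ.* suc d′))

_*ᶠ_ : Frac → Frac → Frac
mkFrac e d *ᶠ mkFrac e′ d′ = mkFrac (e :* e′) (ℕ.pred (suc d ℕ.* suc d′))

-ᶠ_ : Frac → Frac
-ᶠ mkFrac e d = mkFrac (:- e) d

⟦⟧ᶠ-homo-+ : ∀ F G x → ⟦ F +ᶠ G ⟧ᶠ x ≡ ⟦ F ⟧ᶠ x ℚ.+ ⟦ G ⟧ᶠ x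
⟦⟧ᶠ-homo-+ F G x = fromℚᵘ-homo-+ (⟦ F ⟧ᵘ x) (⟦ G ⟧ᵘ x)

⟦⟧ᶠ-homo-* : ∀ F G x → ⟦ F *ᶠ G ⟧ᶠ x ≡ ⟦ F ⟧ᶠ x ℚ.* ⟦ G ⟧ᶠ x
⟦⟧ᶠ-homo-* F G x = fromℚᵘ-homo-* (⟦ F ⟧ᵘ x) (⟦ G ⟧ᵘ x)

⟦⟧ᶠ-homo‿- : ∀ F x → ⟦ -ᶠ F ⟧ᶠ x ≡ ℚ.- ⟦ F ⟧ᶠ x
⟦⟧ᶠ-homo‿- F x = fromℚᵘ-homo‿- (⟦ F ⟧ᵘ x)

isInt⇔∣ : ∀ F x → IsInt (⟦ F ⟧ᶠ x) ⇔ (denominator F Signed.∣ ⟦ numerator F ⟧ x)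
isInt⇔∣ (mkFrac e d) x = isInt-/⇔∣ (⟦ e ⟧ x) (suc d)

infixl 6 _⊕ᶠ_

_⊕ᶠ_ : List Frac → List Frac → List Frac
[]       ⊕ᶠ Gs       = Gs
(F ∷ Fs) ⊕ᶠ []       = F ∷ Fs
(F ∷ Fs) ⊕ᶠ (G ∷ Gs) = F +ᶠ G ∷ Fs ⊕ᶠ Gs

scaleᶠ : Frac → List Frac → List Frac
scaleᶠ C = map (C *ᶠ_)

mulLinᶠ : Frac → List Frac → List Frac
mulLinᶠ C Fs = (0ᶠ ∷ Fs) ⊕ᶠ scaleᶠ C Fs

shiftᶠ : Frac → List Frac → List Frac
shiftᶠ C []       = []
shiftᶠ C (F ∷ Fs) = (F ∷ []) ⊕ᶠ mulLinᶠ C (shiftᶠ C Fs)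

⟦_⟧* : List Frac → ℤ → Poly
⟦ Fs ⟧* x = map (λ F → ⟦ F ⟧ᶠ x) Fs

⟦⟧*-homo-⊕ : ∀ Fs Gs x → ⟦ Fs ⊕ᶠ Gs ⟧* x ≡ ⟦ Fs ⟧* x ⊕ ⟦ Gs ⟧* x
⟦⟧*-homo-⊕ []       Gs       x = refl
⟦⟧*-homo-⊕ (F ∷ Fs) []       x = refl
⟦⟧*-homo-⊕ (F ∷ Fs) (G ∷ Gs) x = cong₂ _∷_ (⟦⟧ᶠ-homo-+ F G x) (⟦⟧*-homo-⊕ Fs Gs x)

⟦⟧*-homo-scale : ∀ C Fs x → ⟦ scaleᶠ C Fs ⟧* x ≡ scale (⟦ C ⟧ᶠ x) (⟦ Fs ⟧* x)
⟦⟧*-homo-scale C []       x = refl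
⟦⟧*-homo-scale C (F ∷ Fs) x = cong₂ _∷_ (⟦⟧ᶠ-homo-* C F x) (⟦⟧*-homo-scale C Fs x)

⟦⟧*-homo-mulLin : ∀ C Fs x → ⟦ mulLinᶠ C Fs ⟧* x ≡ mulLin (⟦ C ⟧ᶠ x) (⟦ Fs ⟧* x)
⟦⟧*-homo-mulLin C Fs x = begin
  ⟦ (0ᶠ ∷ Fs) ⊕ᶠ scaleᶠ C Fs ⟧* x
    ≡⟨ ⟦⟧*-homo-⊕ (0ᶠ ∷ Fs) (scaleᶠ C Fs) x ⟩
  (0ℚ ∷ ⟦ Fs ⟧* x) ⊕ ⟦ scaleᶠ C Fs ⟧* x
    ≡⟨ cong ((0ℚ ∷ ⟦ Fs ⟧* x) ⊕_) (⟦⟧*-homo-scale C Fs x) ⟩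
  (0ℚ ∷ ⟦ Fs ⟧* x) ⊕ scale (⟦ C ⟧ᶠ x) (⟦ Fs ⟧* x)
    ∎
  where open ≡-Reasoning

⟦⟧*-homo-shift : ∀ C Fs x → ⟦ shiftᶠ C Fs ⟧* x ≡ shift (⟦ C ⟧ᶠ x) (⟦ Fs ⟧* x)
⟦⟧*-homo-shift C []       x = refl
⟦⟧*-homo-shift C (F ∷ Fs) x = begin
  ⟦ (F ∷ []) ⊕ᶠ mulLinᶠ C (shiftᶠ C Fs) ⟧* x
    ≡⟨ ⟦⟧*-homo-⊕ (F ∷ []) (mulLinᶠ C (shiftᶠ C Fs)) x ⟩
  (⟦ F ⟧ᶠ x ∷ []) ⊕ ⟦ mulLinᶠ C (shiftᶠ C Fs) ⟧* x
    ≡⟨ cong ((⟦ F ⟧ᶠ x ∷ []) ⊕_) (⟦⟧*-homo-mulLin C (shiftᶠ C Fs) x) ⟩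
  (⟦ F ⟧ᶠ x ∷ []) ⊕ mulLin (⟦ C ⟧ᶠ x) (⟦ shiftᶠ C Fs ⟧* x)
    ≡⟨ cong (λ P → (⟦ F ⟧ᶠ x ∷ []) ⊕ mulLin (⟦ C ⟧ᶠ x) P) (⟦⟧*-homo-shift C Fs x) ⟩
  shift (⟦ C ⟧ᶠ x) (⟦ F ∷ Fs ⟧* x)
    ∎
  where open ≡-Reasoning

IntegralAlong : Expr → Frac → Set
IntegralAlong q F = denominator F ∣ₚ coefficients (numerator F ∘ₑ q)

ObstructedAlong : Expr → Frac → Set
ObstructedAlong q F = denominator F ∤₀ coefficients (numerator F ∘ₑ q)

integralAlong⇒isInt : ∀ q F s → IntegralAlong q F → IsInt (⟦ F ⟧ᶠ (⟦ q ⟧ s))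
integralAlong⇒isInt q F s = Equivalence.from (isInt⇔∣ F (⟦ q ⟧ s)) ∘ ∣ₚ-along (numerator F) q s

obstructedAlong⇒¬isInt : ∀ q F s → ObstructedAlong q F → ¬ IsInt (⟦ F ⟧ᶠ (⟦ q ⟧ s))
obstructedAlong⇒¬isInt q F s obstructed =
  ∤₀-along (numerator F) q s obstructed ∘ Equivalence.to (isInt⇔∣ F (⟦ q ⟧ s))

all-integralAlong⇒InZX : ∀ q {Fs} s → All (IntegralAlong q) Fs → InZX (⟦ Fs ⟧* (⟦ q ⟧ s))
all-integralAlong⇒InZX q s = map⁺ ∘ All.map (λ {F} → integralAlong⇒isInt q F s)

any-obstructedAlong⇒¬InZX : ∀ q {Fs} s → Any (ObstructedAlong q) Fs → ¬ InZX (⟦ Fs ⟧* (⟦ q ⟧ s))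
any-obstructedAlong⇒¬InZX q {F ∷ _} s (here obstructed)  (isInt ∷ _)    =
  obstructedAlong⇒¬isInt q F s obstructed isInt
any-obstructedAlong⇒¬InZX q {_ ∷ _} s (there obstructed) (_ ∷ integral) =
  any-obstructedAlong⇒¬InZX q s obstructed integral

n₂ n₁ n₀ : Expr
n₂ = con (+ 3) :* X :^ 6 :- con (+ 16) :* X :^ 4 :+ con (+ 37) :* X :^ 2 :- con (+ 32)
n₁ = con (+ 2) :* X :^ 9 :- con (+ 19) :* X :^ 7 :+ con (+ 72) :* X :^ 5 :- con (+ 135) :* X :^ 3
     :+ con (+ 96) :* X
n₀ = con (+ 3) :* X :^ 12 :- con (+ 40) :* X :^ 10 :+ con (+ 214) :* X :^ 8 :- con (+ 576) :* X :^ 6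
     :+ con (+ 719) :* X :^ 4 :- con (+ 64) :* X :^ 2 :- con (+ 512)

fᶠ : List Frac
fᶠ = -ᶠ mkFrac n₀ 255 ∷ -ᶠ mkFrac n₁ 15 ∷ -ᶠ mkFrac n₂ 7 ∷ -ᶠ mkFrac X 0 ∷ mkFrac (con 1ℤ) 0 ∷ []

f≡⟦fᶠ⟧ : ∀ z → f z ≡ ⟦ fᶠ ⟧* z
f≡⟦fᶠ⟧ z = Pointwise-≡⇒≡
  ( negated (mkFrac n₀ 255) ∷ negated (mkFrac n₁ 15) ∷ negated (mkFrac n₂ 7)
  ∷ negated (mkFrac X 0) ∷ refl ∷ [])
  where
  negated : ∀ F → ℚ.- ⟦ F ⟧ᶠ z ≡ ⟦ -ᶠ F ⟧ᶠ z
  negated F = sym (⟦⟧ᶠ-homo‿- F z)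

-½ᶠ : Frac
-½ᶠ = mkFrac (con -1ℤ) 1

gᶠ : List Frac
gᶠ = shiftᶠ -½ᶠ fᶠ

shift-f≡⟦gᶠ⟧ : ∀ z → shift (- (+ 1 / 2)) (f z) ≡ ⟦ gᶠ ⟧* z
shift-f≡⟦gᶠ⟧ z = begin
  shift (⟦ -½ᶠ ⟧ᶠ z) (f z)         ≡⟨ cong (shift (⟦ -½ᶠ ⟧ᶠ z)) (f≡⟦fᶠ⟧ z) ⟩
  shift (⟦ -½ᶠ ⟧ᶠ z) (⟦ fᶠ ⟧* z)   ≡⟨ ⟦⟧*-homo-shift -½ᶠ fᶠ z ⟨
  ⟦ gᶠ ⟧* z                       ∎
  where open ≡-Reasoning

Integrality : ℤ → Set
Integrality z = (InZX (f z) ⇔ (¬ (+ 4 ∣ z - + 2))) × (InZX (shift (- (+ 1 / 2)) (f z)) ⇔ (+ 4 ∣ z - + 2))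

Verdict : Expr → Set
Verdict q =
  (+ 4 ∣ₚ coefficients ((X :- con (+ 2)) ∘ₑ q) × Any (ObstructedAlong q) fᶠ × All (IntegralAlong q) gᶠ) ⊎
  (+ 4 ∤₀ coefficients ((X :- con (+ 2)) ∘ₑ q) × All (IntegralAlong q) fᶠ × Any (ObstructedAlong q) gᶠ)

verdict? : ∀ q → Dec (Verdict q)
verdict? q =
  (+ 4 ∣ₚ? coefficients ((X :- con (+ 2)) ∘ₑ q) ×-dec any? obstructed? fᶠ ×-dec all? integral? gᶠ) ⊎-dec
  (+ 4 ∤₀? coefficients ((X :- con (+ 2)) ∘ₑ q) ×-dec all? integral? fᶠ ×-dec any? obstructed? gᶠ)
  where
  integral? : Decidable (IntegralAlong q)
  integral? F = denominator F ∣ₚ? coefficients (numerator F ∘ₑ q)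
  obstructed? : Decidable (ObstructedAlong q)
  obstructed? F = denominator F ∤₀? coefficients (numerator F ∘ₑ q)

verdict-sound : ∀ q → Verdict q → ∀ {z} s → z ≡ ⟦ q ⟧ s → Integrality z
verdict-sound q (inj₁ (4∣ , f-obstructed , g-integral)) s refl =
  mk⇔ (λ f-integral → contradiction f-integral ¬f-integral) (λ 4∤ → contradiction 4∣z-2 4∤) ,
  mk⇔ (const 4∣z-2) (const g-integral′)
  where
  z = ⟦ q ⟧ s
  4∣z-2 : + 4 ∣ z - + 2
  4∣z-2 = ∣⇒∣ᵤ (∣ₚ-along (X :- con (+ 2)) q s 4∣)
  ¬f-integral : ¬ InZX (f z)
  ¬f-integral = any-obstructedAlong⇒¬InZX q s f-obstructed ∘ subst InZX (f≡⟦fᶠ⟧ z)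
  g-integral′ : InZX (shift (- (+ 1 / 2)) (f z))
  g-integral′ = subst InZX (sym (shift-f≡⟦gᶠ⟧ z)) (all-integralAlong⇒InZX q s g-integral)
verdict-sound q (inj₂ (4∤₀ , f-integral , g-obstructed)) s refl =
  mk⇔ (const 4∤z-2) (const f-integral′) ,
  mk⇔ (λ g-integral → contradiction g-integral ¬g-integral) (λ 4∣ → contradiction 4∣ 4∤z-2)
  where
  z = ⟦ q ⟧ s
  4∤z-2 : ¬ (+ 4 ∣ z - + 2)
  4∤z-2 = ∤₀-along (X :- con (+ 2)) q s 4∤₀ ∘ ∣ᵤ⇒∣
  f-integral′ : InZX (f z)
  f-integral′ = subst InZX (sym (f≡⟦fᶠ⟧ z)) (all-integralAlong⇒InZX q s f-integral)
  ¬g-integral : ¬ InZX (shift (- (+ 1 / 2)) (f z))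
  ¬g-integral = any-obstructedAlong⇒¬InZX q s g-obstructed ∘ subst InZX (shift-f≡⟦gᶠ⟧ z)

residueClass : ℕ → Expr
residueClass r = con (+ r) :+ X :* con (+ 4)

residueClass-verdicts : ∀ (r : Fin 4) → Verdict (residueClass (toℕ r))
residueClass-verdicts = from-yes (Fin.all? {n = 4} (verdict? ∘ residueClass ∘ toℕ))

lemma3p1 : (z : ℤ) →
    (InZX (f z) ⇔ (¬ (+ 4 ∣ z - + 2))) ×
    (InZX (shift (- (+ 1 / 2)) (f z)) ⇔ (+ 4 ∣ z - + 2))
lemma3p1 z = verdict-sound (residueClass r) verdict (z ℤ./ + 4) (a≡a%n+[a/n]*n z (+ 4))
  where
  r = z % + 4
  r<4 = n%d<d z (+ 4)
  verdict : Verdict (residueClass r)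
  verdict = subst (Verdict ∘ residueClass) (toℕ-fromℕ< r<4) (residueClass-verdicts (fromℕ< r<4))
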